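{- Let $\varepsilon>0$ and let $l$ be an active line segment containing fewer than $n$ of Maker's points. Then Breaker can $\varepsilon$-split $l$ using at most $2/\varepsilon$ points.
   Context: Maker and Breaker claim points of $\mathbb{Z}^2$. Breaker's claimed points split each line of the plane into line segments: maximal blocks of the line consisting of points unclaimed or claimed by Maker, lying between two of Breaker's points, or between one of Breaker's points and infinity (a ray), or an entire line containing no Breaker point. A line segment is inactive if it contains fewer than $n$ integer points in total, and active otherwise. Breaker $\varepsilon$-splits a line segment $l$ containing some of Maker's points if he places points on $l$ splitting it into smaller line segments such that afterwards no active segment (contained in $l$) contains at least $\varepsilon n$ of Maker's points.
   Formalization: The parameter ε ranges over the positive rationals. -}

module Defs where

open import Data.Bool using (Bool; true; false; _∧_; T)
open import Data.Maybe using (Maybe; just; nothing)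
open import Data.Nat using (ℕ; zero; suc)
open import Data.Integer as ℤ using (ℤ; +_; _-_; _≤ᵇ_)
open import Data.List using (List; []; _∷_; length)
open import Data.List.Membership.Propositional using (_∈_)
open import Data.List.Relation.Unary.All using (All)
open import Data.List.Relation.Unary.Unique.Propositional using (Unique)
open import Data.Unit using (⊤)
open import Data.Product using (Σ; _×_)
open import Data.Sum using (_⊎_)
open import Relation.Nullary using (¬_)
open import Relation.Binary.PropositionalEquality using (_≡_)
open import Data.Rational as ℚ using (ℚ; 0ℚ; _/_)

-- The integer points of a line of ℤ² (containing at least two integer points)
-- form an arithmetic progression p + t·d (t ∈ ℤ, d primitive); we identify
-- them with ℤ via the parameter t.  A (candidate) line segment is then a block
-- of consecutive integers, with optional lower / upper bound (inclusive);
-- 'nothing' means the block is unbounded on that side (ray or whole line).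
record Seg : Set where
  constructor seg
  field
    lo : Maybe ℤ
    hi : Maybe ℤ
open Seg public

aboveᵇ : Maybe ℤ → ℤ → Bool
aboveᵇ nothing  x = true
aboveᵇ (just a) x = a ≤ᵇ x

belowᵇ : Maybe ℤ → ℤ → Bool
belowᵇ nothing  x = true
belowᵇ (just b) x = x ≤ᵇ b

inSegᵇ : Seg → ℤ → Bool
inSegᵇ s x = aboveᵇ (lo s) x ∧ belowᵇ (hi s) x

InSeg : Seg → ℤ → Set
InSeg s x = T (inSegᵇ s x)

countIn : Seg → List ℤ → ℕ
countIn s [] = 0
countIn s (x ∷ xs) with inSegᵇ s x
... | true  = suc (countIn s xs)
... | false = countIn s xs

-- A segment is active if it contains at least n integer points
-- (unbounded segments contain infinitely many).
Active : ℕ → Seg → Set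
Active n (seg nothing  _)        = ⊤
Active n (seg (just a) nothing)  = ⊤
Active n (seg (just a) (just b)) = (+ n) ℤ.≤ (b - a ℤ.+ + 1)

-- J is one of the line segments into which the Breaker points B split l:
-- J ⊆ l, J contains no point of B, and J is maximal: each end of J is either
-- the corresponding end of l, or is immediately adjacent to a point of B.
IsPiece : Seg → List ℤ → Seg → Set
IsPiece l B J =
  (∀ x → InSeg J x → InSeg l x) ×
  (∀ x → x ∈ B → ¬ InSeg J x) ×
  (lo J ≡ lo l ⊎ Σ ℤ (λ a → (lo J ≡ just a) × ((a - + 1) ∈ B))) ×
  (hi J ≡ hi l ⊎ Σ ℤ (λ b → (hi J ≡ just b) × ((b ℤ.+ + 1) ∈ B)))

ℕ→ℚ : ℕ → ℚ
ℕ→ℚ k = (+ k) / 1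

EpsSplits : ℕ → ℚ → Seg → List ℤ → List ℤ → Set
EpsSplits n ε l M B =
  All (InSeg l) B ×
  All (λ x → ¬ x ∈ M) B ×
  (∀ J → IsPiece l B J → Active n J → ℕ→ℚ (countIn J M) ℚ.< ε ℚ.* ℕ→ℚ n)

-- Sort Maker's points and mark every (K+1)-th of them, where K = ⌈εn⌉ − 1 is
-- the largest integer below εn.  Around each marked point c Breaker claims the
-- nearest points below and above c that Maker does not own (those lying on l).
-- The piece containing c then consists of Maker's points only, so it has fewer
-- than n points and is inactive.  Any other piece is an interval avoiding all
-- marked points, so it contains at most K < εn of Maker's points.  As K+1 ≥ εn,
-- there are at most |M|/(K+1) < 1/ε marks, hence at most 2/ε Breaker points.

module Submission where

open import Data.Bool using (T; true; false)
open import Data.Bool.Properties using (T-∧)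
open import Data.Fin using (Fin; toℕ)
import Data.Fin.Properties as Fin
open import Data.Integer as ℤ using (ℤ; +_; _-_; 1ℤ)
import Data.Integer.Properties as ℤ
open import Algebra.Properties.AbelianGroup ℤ.+-0-abelianGroup using (∙-cancelˡ)
import Data.Integer.Tactic.RingSolver as ℤ-Solver
open import Data.List using (List; []; _∷_; length; lookup; map; filter; filterᵇ; _++_)
open import Data.List.Membership.DecPropositional ℤ._≟_ using (_∈?_)
open import Data.List.Membership.Propositional using (_∈_; _∉_; find)
open import Data.List.Membership.Propositional.Properties using (∈-map⁺; ∈-map⁻; ∈-filter⁺; ∈-++⁺ˡ; ∈-++⁺ʳ)
open import Data.List.Properties using (filter-none; length-filter; length-++; length-map)
open import Data.List.Relation.Binary.Permutation.Propositional using (↭-sym)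
open import Data.List.Relation.Binary.Permutation.Propositional.Properties using (↭-length; ∈-resp-↭; filter-↭)
open import Data.List.Relation.Unary.All as All using (All; []; _∷_)
open import Data.List.Relation.Unary.All.Properties using (all-filter; filter⁺; ++⁺; map⁺; ¬Any⇒All¬)
open import Data.List.Relation.Unary.AllPairs using (AllPairs; []; _∷_)
open import Data.List.Relation.Unary.Any using (here; there; index; any?)
open import Data.List.Relation.Unary.Any.Properties using (lookup-index)
open import Data.List.Relation.Unary.Sorted.TotalOrder.Properties using (Sorted⇒AllPairs)
open import Data.List.Relation.Unary.Unique.Propositional using (Unique)
open import Data.List.Sort ℤ.≤-decTotalOrder using (sort; sort-↭; sort-↗)
open import Data.Maybe using (Maybe; just; nothing)
open import Data.Maybe.Relation.Unary.All as Maybe using (just; nothing)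
open import Data.Nat as ℕ using (ℕ; zero; suc; pred; z≤n; s≤s) renaming (_<_ to _<ℕ_)
open import Data.Nat.DivMod using (_/_; _%_; m≡m%n+[m/n]*n; m%n<n; m/n*n≤m)
import Data.Nat.Properties as ℕ
import Data.Nat.Tactic.RingSolver as ℕ-Solver
open import Data.Product using (Σ; ∃; _×_; _,_; proj₁; proj₂)
open import Data.Rational as ℚ using (ℚ; mkℚ; 0ℚ; _<_; _≤_; _*_)
import Data.Rational.Properties as ℚ
open import Data.Rational.Unnormalised as ℚᵘ using (mkℚᵘ)
import Data.Rational.Unnormalised.Properties as ℚᵘ
open import Data.Sum using (_⊎_; inj₁; inj₂)
open import Defs
open import Function using (_∘_; Equivalence)
open import Function.Definitions using (Injective)
open import Relation.Binary.Definitions using (tri<; tri≈; tri>)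
open import Relation.Binary.PropositionalEquality
open import Relation.Nullary using (¬_; yes; no; does; contradiction)
open import Relation.Nullary.Decidable using (T?)
open import Relation.Unary using (Decidable)

open Equivalence using (to; from)

Above Below : Maybe ℤ → ℤ → Set
Above m x = Maybe.All (ℤ._≤ x) m
Below m x = Maybe.All (x ℤ.≤_) m

aboveᵇ⇒Above : ∀ m {x} → T (aboveᵇ m x) → Above m x
aboveᵇ⇒Above nothing  _ = nothing
aboveᵇ⇒Above (just a) h = just (ℤ.≤ᵇ⇒≤ h)

Above⇒aboveᵇ : ∀ {m x} → Above m x → T (aboveᵇ m x)
Above⇒aboveᵇ nothing    = _
Above⇒aboveᵇ (just a≤x) = ℤ.≤⇒≤ᵇ a≤x

belowᵇ⇒Below : ∀ m {x} → T (belowᵇ m x) → Below m x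
belowᵇ⇒Below nothing  _ = nothing
belowᵇ⇒Below (just b) h = just (ℤ.≤ᵇ⇒≤ h)

Below⇒belowᵇ : ∀ {m x} → Below m x → T (belowᵇ m x)
Below⇒belowᵇ nothing    = _
Below⇒belowᵇ (just x≤b) = ℤ.≤⇒≤ᵇ x≤b

inSeg⁺ : ∀ J {x} → Above (lo J) x → Below (hi J) x → InSeg J x
inSeg⁺ J a b = from T-∧ (Above⇒aboveᵇ a , Below⇒belowᵇ b)

inSeg-lo : ∀ J {x} → InSeg J x → Above (lo J) x
inSeg-lo J h = aboveᵇ⇒Above (lo J) (proj₁ (to T-∧ h))

inSeg-hi : ∀ J {x} → InSeg J x → Below (hi J) x
inSeg-hi J h = belowᵇ⇒Below (hi J) (proj₂ (to T-∧ h))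

inSeg-convex : ∀ J {x y z} → x ℤ.≤ y → y ℤ.≤ z → InSeg J x → InSeg J z → InSeg J y
inSeg-convex J x≤y y≤z x∈J z∈J =
  inSeg⁺ J (Maybe.map (λ a≤x → ℤ.≤-trans a≤x x≤y) (inSeg-lo J x∈J))
           (Maybe.map (ℤ.≤-trans y≤z) (inSeg-hi J z∈J))

lo-above : ∀ J {c g} → InSeg J c → ¬ InSeg J g → g ℤ.≤ c → ∃ λ a → lo J ≡ just a × g ℤ.< a
lo-above J@(seg nothing _) c∈J g∉J g≤c =
  contradiction (inSeg⁺ J nothing (Maybe.map (ℤ.≤-trans g≤c) (inSeg-hi J c∈J))) g∉J
lo-above J@(seg (just a) _) {g = g} c∈J g∉J g≤c with a ℤ.≤? g
... | yes a≤g =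
  contradiction (inSeg⁺ J (just a≤g) (Maybe.map (ℤ.≤-trans g≤c) (inSeg-hi J c∈J))) g∉J
... | no  a≰g = a , refl , ℤ.≰⇒> a≰g

hi-below : ∀ J {c f} → InSeg J c → ¬ InSeg J f → c ℤ.≤ f → ∃ λ b → hi J ≡ just b × b ℤ.< f
hi-below J@(seg _ nothing) c∈J f∉J c≤f =
  contradiction (inSeg⁺ J (Maybe.map (λ a≤c → ℤ.≤-trans a≤c c≤f) (inSeg-lo J c∈J)) nothing) f∉J
hi-below J@(seg _ (just b)) {f = f} c∈J f∉J c≤f with f ℤ.≤? b
... | yes f≤b =
  contradiction (inSeg⁺ J (Maybe.map (λ a≤c → ℤ.≤-trans a≤c c≤f) (inSeg-lo J c∈J)) (just f≤b)) f∉J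
... | no  f≰b = b , refl , ℤ.≰⇒> f≰b

injection⇒≤length : ∀ {A : Set} {k} {xs : List A} (f : Fin k → A) →
                    Injective _≡_ _≡_ f → (∀ i → f i ∈ xs) → k ℕ.≤ length xs
injection⇒≤length {k = k} {xs} f f-inj f∈xs with k ℕ.≤? length xs
... | yes k≤∣xs∣ = k≤∣xs∣
... | no  k≰∣xs∣ with Fin.pigeonhole (ℕ.≰⇒> k≰∣xs∣) (index ∘ f∈xs)
...   | i , j , i<j , same-index = contradiction (f-inj f[i]≡f[j]) (Fin.<⇒≢ i<j)
  where
  f[i]≡f[j] : f i ≡ f j
  f[i]≡f[j] = begin
    f i                          ≡⟨ lookup-index (f∈xs i) ⟩
    lookup xs (index (f∈xs i))   ≡⟨ cong (lookup xs) same-index ⟩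
    lookup xs (index (f∈xs j))   ≡⟨ lookup-index (f∈xs j) ⟨
    f j                          ∎
    where open ≡-Reasoning

x<x+[1+j] : ∀ x j → x ℤ.< x ℤ.+ + suc j
x<x+[1+j] x j = subst (ℤ._< x ℤ.+ + suc j) (ℤ.+-identityʳ x) (ℤ.+-monoʳ-< x (ℤ.+<+ (s≤s z≤n)))

window⊆⇒≤length : ∀ {M : List ℤ} x k →
                  (∀ z → x ℤ.< z → z ℤ.≤ x ℤ.+ + k → z ∈ M) → k ℕ.≤ length M
window⊆⇒≤length x k window⊆M =
  injection⇒≤length (λ i → x ℤ.+ + suc (toℕ i)) shift-injective
    (λ i → window⊆M _ (x<x+[1+j] x (toℕ i)) (ℤ.+-monoʳ-≤ x (ℤ.+≤+ (Fin.toℕ<n i))))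
  where
  shift-injective : Injective _≡_ _≡_ (λ i → x ℤ.+ + suc (toℕ i))
  shift-injective eq = Fin.toℕ-injective (ℕ.suc-injective (ℤ.+-injective (∙-cancelˡ x _ _ eq)))

Between : (ℤ → Set) → ℤ → ℤ → Set
Between P x y = ∀ z → x ℤ.< z → z ℤ.< y → P z

<⇒≡suc⊎suc< : ∀ {x z} → x ℤ.< z → z ≡ 1ℤ ℤ.+ x ⊎ 1ℤ ℤ.+ x ℤ.< z
<⇒≡suc⊎suc< {x} {z} x<z with 1ℤ ℤ.+ x ℤ.≟ z
... | yes 1+x≡z = inj₁ (sym 1+x≡z)
... | no  1+x≢z = inj₂ (ℤ.≤∧≢⇒< (ℤ.i<j⇒suc[i]≤j x<z) 1+x≢z)

extendDown : ∀ {P Q : ℤ → Set} {x} → P (1ℤ ℤ.+ x) →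
             (∀ z → 1ℤ ℤ.+ x ℤ.< z → Q z → P z) → ∀ z → x ℤ.< z → Q z → P z
extendDown P[1+x] above z x<z q with <⇒≡suc⊎suc< x<z
... | inj₁ refl  = P[1+x]
... | inj₂ 1+x<z = above z 1+x<z q

x<1+x : ∀ x → x ℤ.< 1ℤ ℤ.+ x
x<1+x x = ℤ.suc[i]≤j⇒i<j ℤ.≤-refl

x+[1+k]≡[1+x]+k : ∀ x k → x ℤ.+ (1ℤ ℤ.+ k) ≡ (1ℤ ℤ.+ x) ℤ.+ k
x+[1+k]≡[1+x]+k = ℤ-Solver.solve-∀

module _ {P : ℤ → Set} (P? : Decidable P) where

  scanAbove : ∀ k x → (∀ z → x ℤ.< z → z ℤ.≤ x ℤ.+ + k → P z) ⊎
                      ∃ λ y → x ℤ.< y × ¬ P y × Between P x y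
  scanAbove zero x =
    inj₁ λ z x<z z≤x+0 → contradiction (subst (z ℤ.≤_) (ℤ.+-identityʳ x) z≤x+0) (ℤ.<⇒≱ x<z)
  scanAbove (suc k) x with P? (1ℤ ℤ.+ x)
  ... | no ¬P[1+x] = inj₂ (1ℤ ℤ.+ x , x<1+x x , ¬P[1+x] ,
                           λ z x<z z<1+x → contradiction (ℤ.i<j⇒suc[i]≤j x<z) (ℤ.<⇒≱ z<1+x))
  ... | yes P[1+x] with scanAbove k (1ℤ ℤ.+ x)
  ...   | inj₁ window = inj₁ (extendDown P[1+x] λ z 1+x<z z≤x+[1+k] →
                          window z 1+x<z (subst (z ℤ.≤_) (x+[1+k]≡[1+x]+k x (+ k)) z≤x+[1+k]))
  ...   | inj₂ (y , 1+x<y , ¬Py , between) =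
          inj₂ (y , ℤ.<-trans (x<1+x x) 1+x<y , ¬Py , extendDown P[1+x] between)

nextOutside : ∀ (M : List ℤ) x → ∃ λ y → x ℤ.< y × y ∉ M × Between (_∈ M) x y
nextOutside M x with scanAbove (_∈? M) (suc (length M)) x
... | inj₁ window⊆M = contradiction (window⊆⇒≤length x (suc (length M)) window⊆M) (ℕ.n≮n _)
... | inj₂ next     = next

prevOutside : ∀ (M : List ℤ) x → ∃ λ y → y ℤ.< x × y ∉ M × Between (_∈ M) y x
prevOutside M x with nextOutside (map ℤ.-_ M) (ℤ.- x)
... | y , -x<y , y∉-M , between = ℤ.- y , -y<x , -y∉M , between′
  where
  -y<x : ℤ.- y ℤ.< x
  -y<x = subst (ℤ.- y ℤ.<_) (ℤ.neg-involutive x) (ℤ.neg-mono-< -x<y)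
  -y∉M : ℤ.- y ∉ M
  -y∉M -y∈M = y∉-M (subst (_∈ map ℤ.-_ M) (ℤ.neg-involutive y) (∈-map⁺ ℤ.-_ -y∈M))
  between′ : Between (_∈ M) (ℤ.- y) x
  between′ z -y<z z<x with ∈-map⁻ ℤ.-_ (between (ℤ.- z) (ℤ.neg-mono-< z<x)
                                   (subst (ℤ.- z ℤ.<_) (ℤ.neg-involutive y) (ℤ.neg-mono-< -y<z)))
  ... | w , w∈M , -z≡-w = subst (_∈ M) (sym (ℤ.neg-injective -z≡-w)) w∈M

Between-join : ∀ {P : ℤ → Set} {g c f} → P c → Between P g c → Between P c f → Between P g f
Between-join {c = c} Pc below above z g<z z<f with ℤ.<-cmp z c
... | tri< z<c _ _ = below z g<z z<c
... | tri≈ _ refl _ = Pc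
... | tri> _ _ c<z = above z c<z z<f

a+[b-a+1]≡1+b : ∀ a b → a ℤ.+ (b - a ℤ.+ 1ℤ) ≡ 1ℤ ℤ.+ b
a+[b-a+1]≡1+b = ℤ-Solver.solve-∀

active-inside⇒≤length : ∀ {M : List ℤ} n J {c g f} → Active n J →
  InSeg J c → ¬ InSeg J g → ¬ InSeg J f → g ℤ.< c → c ℤ.< f → Between (_∈ M) g f →
  n ℕ.≤ length M
active-inside⇒≤length n J@(seg _ _) {g = g} active c∈J g∉J f∉J g<c c<f between
  with lo-above J c∈J g∉J (ℤ.<⇒≤ g<c) | hi-below J c∈J f∉J (ℤ.<⇒≤ c<f)
... | a , refl , g<a | b , refl , b<f =
  -- J = [a, b] has at least n points and g < a, so g + 1, …, g + n all lie in J ⊆ (g, f).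
  window⊆⇒≤length g n λ z g<z z≤g+n → between z g<z (ℤ.≤-<-trans (ℤ.≤-trans z≤g+n g+n≤b) b<f)
  where
  g+n≤b : g ℤ.+ + n ℤ.≤ b
  g+n≤b = subst (g ℤ.+ + n ℤ.≤_) (ℤ.pred-suc b) (ℤ.i<j⇒i≤pred[j] (begin-strict
    g ℤ.+ + n                <⟨ ℤ.+-monoˡ-< (+ n) g<a ⟩
    a ℤ.+ + n                ≤⟨ ℤ.+-monoʳ-≤ a active ⟩
    a ℤ.+ (b - a ℤ.+ 1ℤ)     ≡⟨ a+[b-a+1]≡1+b a b ⟩
    1ℤ ℤ.+ b                 ∎))
    where open ℤ.≤-Reasoning

countIn≡length-filterᵇ : ∀ J xs → countIn J xs ≡ length (filterᵇ (inSegᵇ J) xs)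
countIn≡length-filterᵇ J [] = refl
countIn≡length-filterᵇ J (x ∷ xs) with inSegᵇ J x
... | true  = cong suc (countIn≡length-filterᵇ J xs)
... | false = countIn≡length-filterᵇ J xs

module _ {A : Set} (K : ℕ) where

  strided : ℕ → List A → List A
  strided _       []       = []
  strided zero    (x ∷ xs) = x ∷ strided K xs
  strided (suc i) (x ∷ xs) = strided i xs

  strided-⊆ : ∀ i {xs x} → x ∈ strided i xs → x ∈ xs
  strided-⊆ zero    {_ ∷ _} (here refl) = here refl
  strided-⊆ zero    {_ ∷ _} (there x∈) = there (strided-⊆ K x∈)
  strided-⊆ (suc i) {_ ∷ _} x∈         = there (strided-⊆ i x∈)

  strided-length : ∀ i xs → i ℕ.≤ K → i ℕ.+ length (strided i xs) ℕ.* suc K ℕ.≤ length xs ℕ.+ K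
  strided-length i       []       i≤K = ℕ.≤-trans (ℕ.≤-reflexive (ℕ.+-identityʳ i)) i≤K
  strided-length zero    (x ∷ xs) _   = s≤s (strided-length K xs ℕ.≤-refl)
  strided-length (suc i) (x ∷ xs) i<K = s≤s (strided-length i xs (ℕ.<⇒≤ i<K))

Convex : (ℤ → Set) → Set
Convex Q = ∀ {x y z} → x ℤ.≤ y → y ℤ.≤ z → Q x → Q z → Q y

length-filter-∷ : ∀ {A : Set} {Q : A → Set} (Q? : Decidable Q) x xs →
                  length (filter Q? (x ∷ xs)) ℕ.≤ suc (length (filter Q? xs))
length-filter-∷ Q? x xs with does (Q? x)
... | true  = ℕ.≤-refl
... | false = ℕ.n≤1+n _

module _ {Q : ℤ → Set} (Q? : Decidable Q) (convex : Convex Q) (K : ℕ) where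

  length-filter≤gap : ∀ i {w xs} → Q w → All (w ℤ.≤_) xs → AllPairs ℤ._≤_ xs →
                      All (¬_ ∘ Q) (strided K i xs) → length (filter Q? xs) ℕ.≤ i
  length-filter≤gap i       {xs = []}    _  _ _ _ = z≤n
  length-filter≤gap zero    {xs = x ∷ xs} Qw (w≤x ∷ _) (x≤xs ∷ _) (¬Qx ∷ _) =
    ℕ.≤-reflexive (cong length (filter-none Q? (¬Qx ∷ All.map (λ x≤y Qy → ¬Qx (convex w≤x x≤y Qw Qy))
                                                               x≤xs)))
  length-filter≤gap (suc i) {xs = x ∷ xs} Qw (_ ∷ w≤xs) (_ ∷ sorted) missed =
    ℕ.≤-trans (length-filter-∷ Q? x xs) (s≤s (length-filter≤gap i Qw w≤xs sorted missed))

  length-filter≤stride : ∀ i {xs} → i ℕ.≤ K → AllPairs ℤ._≤_ xs →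
                         All (¬_ ∘ Q) (strided K i xs) → length (filter Q? xs) ℕ.≤ K
  length-filter≤stride i {[]} _ _ _ = z≤n
  length-filter≤stride i {x ∷ xs} i≤K (x≤xs ∷ sorted) missed with Q? x
  length-filter≤stride zero    {x ∷ xs} _   _                (¬Qx ∷ _) | yes Qx = contradiction Qx ¬Qx
  length-filter≤stride (suc i) {x ∷ xs} i<K (x≤xs ∷ sorted) missed    | yes Qx =
    ℕ.≤-trans (s≤s (length-filter≤gap i Qx x≤xs sorted missed)) i<K
  length-filter≤stride zero    {x ∷ xs} _   (_ ∷ sorted) (_ ∷ missed) | no ¬Qx =
    length-filter≤stride K ℕ.≤-refl sorted missed
  length-filter≤stride (suc i) {x ∷ xs} i<K (_ ∷ sorted) missed       | no ¬Qx =
    length-filter≤stride i (ℕ.<⇒≤ i<K) sorted missed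

inSeg? : ∀ J → Decidable (InSeg J)
inSeg? J x = T? (inSegᵇ J x)

module Strategy (K : ℕ) (l : Seg) (M : List ℤ) where

  cuts : List ℤ
  cuts = strided K K (sort M)

  next prev : ℤ → ℤ
  next c = proj₁ (nextOutside M c)
  prev c = proj₁ (prevOutside M c)

  prev<c : ∀ c → prev c ℤ.< c
  prev<c c = proj₁ (proj₂ (prevOutside M c))

  prev∉M : ∀ c → prev c ∉ M
  prev∉M c = proj₁ (proj₂ (proj₂ (prevOutside M c)))

  c<next : ∀ c → c ℤ.< next c
  c<next c = proj₁ (proj₂ (nextOutside M c))

  next∉M : ∀ c → next c ∉ M
  next∉M c = proj₁ (proj₂ (proj₂ (nextOutside M c)))

  run : ∀ {c} → c ∈ M → Between (_∈ M) (prev c) (next c)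
  run {c} c∈M = Between-join c∈M (proj₂ (proj₂ (proj₂ (prevOutside M c))))
                                 (proj₂ (proj₂ (proj₂ (nextOutside M c))))

  candidates breakerPoints : List ℤ
  candidates    = map prev cuts ++ map next cuts
  breakerPoints = filter (inSeg? l) candidates

  breakerPoints-onLine : All (InSeg l) breakerPoints
  breakerPoints-onLine = all-filter (inSeg? l) candidates

  breakerPoints-outside : All (_∉ M) breakerPoints
  breakerPoints-outside = filter⁺ (inSeg? l) {xs = candidates}
    (++⁺ (map⁺ (All.universal prev∉M cuts)) (map⁺ (All.universal next∉M cuts)))

  cuts-length : length cuts ℕ.* suc K ℕ.≤ length M
  cuts-length = ℕ.+-cancelˡ-≤ K _ _ (begin
    K ℕ.+ length cuts ℕ.* suc K   ≤⟨ strided-length K K (sort M) ℕ.≤-refl ⟩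
    length (sort M) ℕ.+ K         ≡⟨ cong (ℕ._+ K) (↭-length (sort-↭ M)) ⟩
    length M ℕ.+ K                ≡⟨ ℕ.+-comm (length M) K ⟩
    K ℕ.+ length M                ∎)
    where open ℕ.≤-Reasoning

  breakerPoints-length : length breakerPoints ℕ.* suc K ℕ.≤ 2 ℕ.* length M
  breakerPoints-length = begin
    length breakerPoints ℕ.* suc K                         ≤⟨ ℕ.*-monoˡ-≤ (suc K) (length-filter _ candidates) ⟩
    length candidates ℕ.* suc K                            ≡⟨ cong (ℕ._* suc K) lengths ⟩
    (length cuts ℕ.+ length cuts) ℕ.* suc K                ≡⟨ ℕ.*-distribʳ-+ (suc K) (length cuts) _ ⟩
    length cuts ℕ.* suc K ℕ.+ length cuts ℕ.* suc K        ≤⟨ ℕ.+-mono-≤ cuts-length cuts-length ⟩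
    length M ℕ.+ length M                                  ≡⟨ cong (length M ℕ.+_) (ℕ.+-identityʳ (length M)) ⟨
    2 ℕ.* length M                                         ∎
    where
    open ℕ.≤-Reasoning
    lengths : length candidates ≡ length cuts ℕ.+ length cuts
    lengths = trans (length-++ (map prev cuts))
                    (cong₂ ℕ._+_ (length-map prev cuts) (length-map next cuts))

  cut-neighbours∉piece : ∀ {J c} → IsPiece l breakerPoints J → c ∈ cuts →
                         ¬ InSeg J (prev c) × ¬ InSeg J (next c)
  cut-neighbours∉piece {c = c} (J⊆l , J∩B=∅ , _) c∈cuts =
      (λ prev∈J → J∩B=∅ _ (claimed (∈-++⁺ˡ (∈-map⁺ prev c∈cuts)) (J⊆l _ prev∈J)) prev∈J)
    , (λ next∈J → J∩B=∅ _ (claimed (∈-++⁺ʳ (map prev cuts) (∈-map⁺ next c∈cuts)) (J⊆l _ next∈J)) next∈J)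
    where
    claimed : ∀ {x} → x ∈ candidates → InSeg l x → x ∈ breakerPoints
    claimed = ∈-filter⁺ (inSeg? l)

  piece-countIn≤ : ∀ {n J} → length M ℕ.< n → IsPiece l breakerPoints J → Active n J →
                   countIn J M ℕ.≤ K
  piece-countIn≤ {n} {J} ∣M∣<n piece active with any? (inSeg? J) cuts
  ... | yes hit with find hit
  ...   | c , c∈cuts , c∈J =
    contradiction (active-inside⇒≤length n J active c∈J prev∉J next∉J (prev<c c) (c<next c) (run c∈M))
                  (ℕ.<⇒≱ ∣M∣<n)
    where
    c∈M = ∈-resp-↭ (sort-↭ M) (strided-⊆ K K c∈cuts)
    prev∉J = proj₁ (cut-neighbours∉piece piece c∈cuts)
    next∉J = proj₂ (cut-neighbours∉piece piece c∈cuts)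
  piece-countIn≤ {n} {J} ∣M∣<n piece active | no miss = begin
    countIn J M                            ≡⟨ countIn≡length-filterᵇ J M ⟩
    length (filter (inSeg? J) M)           ≡⟨ ↭-length (filter-↭ (inSeg? J) (↭-sym (sort-↭ M))) ⟩
    length (filter (inSeg? J) (sort M))    ≤⟨ length-filter≤stride (inSeg? J) (inSeg-convex J) K K ℕ.≤-refl
                                                (Sorted⇒AllPairs ℤ.≤-totalOrder (sort-↗ M)) (¬Any⇒All¬ cuts miss) ⟩
    K                                      ∎
    where open ℕ.≤-Reasoning

toℚᵘ-ℕ→ℚ : ∀ k → ℚ.toℚᵘ (ℕ→ℚ k) ℚᵘ.≃ mkℚᵘ (+ k) 0
toℚᵘ-ℕ→ℚ k = ℚ.toℚᵘ-fromℚᵘ (mkℚᵘ (+ k) 0)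

toℚᵘ-*ℕ→ℚ : ∀ ε k → ℚ.toℚᵘ (ε ℚ.* ℕ→ℚ k) ℚᵘ.≃ ℚ.toℚᵘ ε ℚᵘ.* mkℚᵘ (+ k) 0
toℚᵘ-*ℕ→ℚ ε k =
  ℚᵘ.≃-trans (ℚ.toℚᵘ-homo-* ε (ℕ→ℚ k)) (ℚᵘ.*-congˡ {ℚ.toℚᵘ ε} (toℚᵘ-ℕ→ℚ k))

-- Both comparisons are proved in ℚᵘ, where they are plain cross-multiplications.
module _ {ε : ℚ} {P d : ℕ} (ε≡P/[1+d] : ℚ.toℚᵘ ε ≡ mkℚᵘ (+ P) d) where

  private
    +[a*[1+d]] : ∀ a → + (a ℕ.* suc d) ≡ + a ℤ.* + (suc d ℕ.* 1)
    +[a*[1+d]] a = trans (cong (λ e → + (a ℕ.* e)) (sym (ℕ.*-identityʳ (suc d)))) (ℤ.pos-* a _)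

    +[P*a] : ∀ a → + (P ℕ.* a) ≡ (+ P ℤ.* + a) ℤ.* 1ℤ
    +[P*a] a = trans (ℤ.pos-* P a) (sym (ℤ.*-identityʳ _))

  ℕ→ℚ<ε*ℕ→ℚ : ∀ a b → a ℕ.* suc d ℕ.< P ℕ.* b → ℕ→ℚ a ℚ.< ε ℚ.* ℕ→ℚ b
  ℕ→ℚ<ε*ℕ→ℚ a b a*[1+d]<P*b = ℚ.toℚᵘ-cancel-<
    (ℚᵘ.<-respʳ-≃ (ℚᵘ.≃-sym (toℚᵘ-*ℕ→ℚ ε b)) (ℚᵘ.<-respˡ-≃ (ℚᵘ.≃-sym (toℚᵘ-ℕ→ℚ a))
      (subst (λ q → mkℚᵘ (+ a) 0 ℚᵘ.< q ℚᵘ.* mkℚᵘ (+ b) 0) (sym ε≡P/[1+d])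
        (ℚᵘ.*<* (subst₂ ℤ._<_ (+[a*[1+d]] a) (+[P*a] b) (ℤ.+<+ a*[1+d]<P*b))))))

  ε*ℕ→ℚ≤ℕ→ℚ : ∀ a b → P ℕ.* a ℕ.≤ b ℕ.* suc d → ε ℚ.* ℕ→ℚ a ℚ.≤ ℕ→ℚ b
  ε*ℕ→ℚ≤ℕ→ℚ a b P*a≤b*[1+d] = ℚ.toℚᵘ-cancel-≤
    (ℚᵘ.≤-respˡ-≃ (ℚᵘ.≃-sym (toℚᵘ-*ℕ→ℚ ε a)) (ℚᵘ.≤-respʳ-≃ (ℚᵘ.≃-sym (toℚᵘ-ℕ→ℚ b))
      (subst (λ q → q ℚᵘ.* mkℚᵘ (+ a) 0 ℚᵘ.≤ mkℚᵘ (+ b) 0) (sym ε≡P/[1+d])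
        (ℚᵘ.*≤* (subst₂ ℤ._≤_ (+[P*a] a) (+[a*[1+d]] b) (ℤ.+≤+ P*a≤b*[1+d]))))))

m<[1+m/n]*n : ∀ m n .{{_ : ℕ.NonZero n}} → m ℕ.< suc (m / n) ℕ.* n
m<[1+m/n]*n m n = begin-strict
  m                       ≡⟨ m≡m%n+[m/n]*n m n ⟩
  m % n ℕ.+ m / n ℕ.* n   <⟨ ℕ.+-monoˡ-< (m / n ℕ.* n) (m%n<n m n) ⟩
  n ℕ.+ m / n ℕ.* n       ∎
  where open ℕ.≤-Reasoning

breaker-budget : ∀ P n K Q {b m} → P ℕ.* n ℕ.≤ suc K ℕ.* Q → m ℕ.≤ n → b ℕ.* suc K ℕ.≤ 2 ℕ.* m →
                 P ℕ.* b ℕ.≤ 2 ℕ.* Q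
breaker-budget P n K Q {b} {m} Pn≤[1+K]Q m≤n b[1+K]≤2m =
  ℕ.*-cancelʳ-≤ (P ℕ.* b) (2 ℕ.* Q) (suc K) (begin
  P ℕ.* b ℕ.* suc K        ≡⟨ ℕ.*-assoc P b (suc K) ⟩
  P ℕ.* (b ℕ.* suc K)      ≤⟨ ℕ.*-monoʳ-≤ P (ℕ.≤-trans b[1+K]≤2m (ℕ.*-monoʳ-≤ 2 m≤n)) ⟩
  P ℕ.* (2 ℕ.* n)          ≡⟨ reorder₁ P n ⟩
  2 ℕ.* (P ℕ.* n)          ≤⟨ ℕ.*-monoʳ-≤ 2 Pn≤[1+K]Q ⟩
  2 ℕ.* (suc K ℕ.* Q)      ≡⟨ reorder₂ (suc K) Q ⟩
  2 ℕ.* Q ℕ.* suc K        ∎)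
  where
  open ℕ.≤-Reasoning
  reorder₁ : ∀ P n → P ℕ.* (2 ℕ.* n) ≡ 2 ℕ.* (P ℕ.* n)
  reorder₁ = ℕ-Solver.solve-∀
  reorder₂ : ∀ k Q → 2 ℕ.* (k ℕ.* Q) ≡ 2 ℕ.* Q ℕ.* k
  reorder₂ = ℕ-Solver.solve-∀

lemma1 : (n : ℕ) (ε : ℚ) → 0ℚ < ε →
    (l : Seg) → Active n l →
    (M : List ℤ) → Unique M → All (InSeg l) M → length M <ℕ n →
    Σ (List ℤ) (λ B → EpsSplits n ε l M B × (ε * ℕ→ℚ (length B) ≤ ℕ→ℚ 2))
lemma1 zero _ _ _ _ _ _ _ ()
lemma1 _ (mkℚ (+ zero)   _ _) (ℚ.*<* (ℤ.+<+ ())) _ _ _ _ _ _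
lemma1 _ (mkℚ ℤ.-[1+ _ ] _ _) (ℚ.*<* ())         _ _ _ _ _ _
lemma1 n@(suc _) ε@(mkℚ (+ P@(suc _)) d _) _ l _ M _ _ ∣M∣<n =
  breakerPoints , (breakerPoints-onLine , breakerPoints-outside , few-Maker-points) , few-Breaker-points
  where
  -- K = ⌈P n / (1+d)⌉ − 1 is the largest K with K (1+d) < P n, i.e. K < εn.
  K = pred (P ℕ.* n) / suc d
  open Strategy K l M

  few-Maker-points : ∀ J → IsPiece l breakerPoints J → Active n J → ℕ→ℚ (countIn J M) < ε * ℕ→ℚ n
  few-Maker-points J piece active = ℕ→ℚ<ε*ℕ→ℚ refl (countIn J M) n (begin-strict
    countIn J M ℕ.* suc d     ≤⟨ ℕ.*-monoˡ-≤ (suc d) (piece-countIn≤ ∣M∣<n piece active) ⟩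
    K ℕ.* suc d               ≤⟨ m/n*n≤m (pred (P ℕ.* n)) (suc d) ⟩
    pred (P ℕ.* n)            <⟨ ℕ.n<1+n _ ⟩
    P ℕ.* n                   ∎)
    where open ℕ.≤-Reasoning

  few-Breaker-points : ε * ℕ→ℚ (length breakerPoints) ≤ ℕ→ℚ 2
  few-Breaker-points = ε*ℕ→ℚ≤ℕ→ℚ refl (length breakerPoints) 2
    (breaker-budget P n K (suc d) (m<[1+m/n]*n (pred (P ℕ.* n)) (suc d)) (ℕ.<⇒≤ ∣M∣<n) breakerPoints-length)
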